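{- For every rational $u$ (so $2-u^2\neq 0$), let $p = u(4u^4-7u^2+16)$, $q = 4u^4-19u^2+4$, $r = u(4u^4-19u^2+4)$, $s = 8(u^2+1)(2-u^2)$ and $a = \frac{4u^2+1}{8(2-u^2)}$. Then $pq(p^2+q^2) = a\,rs(r^2+s^2)$; equivalently $A=p+q$, $B=r-s$, $C=p-q$, $D=r+s$ satisfy $A^4 + aB^4 = C^4 + aD^4$. -}

module Defs where

open import Data.Rational using (ℚ; 0ℚ; 1ℚ; _+_; _*_; _-_; _÷_; 1/_; NonZero; ≢-nonZero)
open import Relation.Binary.PropositionalEquality using (_≢_)

ℚ2 ℚ4 ℚ7 ℚ8 ℚ16 ℚ19 : ℚ
ℚ2 = 1ℚ + 1ℚ
ℚ4 = ℚ2 + ℚ2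
ℚ8 = ℚ4 + ℚ4
ℚ16 = ℚ8 + ℚ8
ℚ7 = ℚ4 + ℚ2 + 1ℚ
ℚ19 = ℚ16 + ℚ2 + 1ℚ

_⁴ : ℚ → ℚ
x ⁴ = x * x * x * x

module Param (u : ℚ) where
  u² : ℚ
  u² = u * u

  p q r s : ℚ
  p = u * (ℚ4 * u² * u² - ℚ7 * u² + ℚ16)
  q = ℚ4 * u² * u² - ℚ19 * u² + ℚ4
  r = u * (ℚ4 * u² * u² - ℚ19 * u² + ℚ4)
  s = ℚ8 * (u² + 1ℚ) * (ℚ2 - u²)

  a : ℚ2 - u² ≢ 0ℚ → ℚ
  a h = ((ℚ4 * u² + 1ℚ) ÷ ℚ8) * (1/_ (ℚ2 - u²) {{≢-nonZero h}})

module Submission where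

-- Proof idea.  For rational u put d = 2 - u², N = 4u² + 1, so that
-- a = N/(8d).  The theorem has three ingredients:
--
--  * d ≠ 0, because 2 is not the square of a rational.  More generally
--    no prime p is a rational square: clearing denominators in u² = p
--    gives coprime m, n with m² = p·n², and the classical descent
--    (p ∣ m, hence p ∣ n) contradicts coprimality.
--  * the biquadratic relation pq(p²+q²) = a·rs(r²+s²): multiplied out by
--    8d it becomes a polynomial identity in u, checked by the ring solver,
--    and then 8 and d are divided out again.
--  * the quartic relation, which follows from the biquadratic one for ANY
--    p, q, r, s, a by the binomial identity
--    (x + y)⁴ - (x - y)⁴ = 8xy(x² + y²).

open import Defs
open import Data.Rational using (ℚ; 0ℚ; _+_; _*_; _-_)
open import Data.Product using (Σ; _×_)
open import Relation.Binary.PropositionalEquality using (_≡_; _≢_)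

open import Data.Rational using (1ℚ; mkℚ; mkℚ+; 1/_; NonZero; ≢-nonZero)
open import Data.Rational.Properties
  using (toℚᵘ-homo-*; toℚᵘ-cong; *-inverseʳ; *-identityʳ; *-assoc; +-0-group)
open import Algebra.Properties.Group +-0-group using (x∙y⁻¹≈ε⇒x≈y)
import Data.Rational.Unnormalised as ℚᵘ
open import Data.Rational.Unnormalised.Properties using (≃-trans; ≃-sym)
import Data.Rational.Solver as ℚ-Solver
open import Data.Nat as ℕ using (ℕ; suc)
import Data.Nat.Properties as ℕ
import Data.Nat.Solver as ℕ-Solver
open import Data.Nat.Divisibility using (_∣_; divides)
open import Data.Nat.Primality using (Prime; euclidsLemma; prime⇒nonZero; ¬prime[1]; prime[2])
open import Data.Nat.Coprimality as Coprimality using (Coprime; 1-coprimeTo)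
open import Data.Integer as ℤ using (+_; ∣_∣)
import Data.Integer.Properties as ℤ
open import Data.Sum using ([_,_])
open import Data.Product using (_,_)
open import Function using (id)
open import Relation.Binary.PropositionalEquality using (refl; sym; trans; cong; subst; module ≡-Reasoning)

prime∣square⇒prime∣ : ∀ {p} m → Prime p → p ∣ m ℕ.* m → p ∣ m
prime∣square⇒prime∣ m pp p∣m² = [ id , id ] (euclidsLemma m m pp p∣m²)

-- Descent: m² = p·n² with p prime forces p to divide both m and n,
-- so m and n cannot be coprime.
coprime-square≢prime*square : ∀ {p m n} → Prime p → Coprime m n →
                              m ℕ.* m ≢ p ℕ.* (n ℕ.* n)
coprime-square≢prime*square {p} {m} {n} pp coprime m²≡pn²
  with prime∣square⇒prime∣ m pp (divides (n ℕ.* n) (trans m²≡pn² (ℕ.*-comm p (n ℕ.* n))))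
... | divides k refl = ¬prime[1] (subst Prime (coprime (divides k refl , p∣n)) pp)
  where
  instance
    p≢0 : ℕ.NonZero p
    p≢0 = prime⇒nonZero pp
  -- with m = k·p, cancelling one factor p from m² = p·n² leaves n² = p·k²
  n²≡pk² : n ℕ.* n ≡ p ℕ.* (k ℕ.* k)
  n²≡pk² = ℕ.*-cancelˡ-≡ (n ℕ.* n) (p ℕ.* (k ℕ.* k)) p (begin
    p ℕ.* (n ℕ.* n)        ≡⟨ sym m²≡pn² ⟩
    k ℕ.* p ℕ.* (k ℕ.* p)  ≡⟨ solve 2 (λ k p → k :* p :* (k :* p) := p :* (p :* (k :* k))) refl k p ⟩
    p ℕ.* (p ℕ.* (k ℕ.* k)) ∎)
    where open ≡-Reasoning; open ℕ-Solver.+-*-Solver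
  p∣n : p ∣ n
  p∣n = prime∣square⇒prime∣ n pp (divides (k ℕ.* k) (trans n²≡pk² (ℕ.*-comm p (k ℕ.* k))))

_/1 : ℕ → ℚ
n /1 = mkℚ+ n 1 (Coprimality.sym (1-coprimeTo n))

-- No prime is the square of a rational: write u = m/n in lowest terms.
square≢prime : ∀ {p} → Prime p → (u : ℚ) → u * u ≢ p /1
square≢prime {p} pp u@(mkℚ m d coprime) u²≡p
  with ≃-trans (≃-sym (toℚᵘ-homo-* u u)) (toℚᵘ-cong u²≡p)
... | ℚᵘ.*≡* cross = coprime-square≢prime*square pp (Coprimality.recompute coprime) (begin
    ∣ m ∣ ℕ.* ∣ m ∣               ≡⟨ sym (ℤ.abs-* m m) ⟩
    ∣ m ℤ.* m ∣                   ≡⟨ cong ∣_∣ (sym (ℤ.*-identityʳ (m ℤ.* m))) ⟩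
    ∣ m ℤ.* m ℤ.* + 1 ∣           ≡⟨ cong ∣_∣ cross ⟩
    ∣ + p ℤ.* + (suc d ℕ.* suc d) ∣ ≡⟨ ℤ.abs-* (+ p) (+ (suc d ℕ.* suc d)) ⟩
    p ℕ.* (suc d ℕ.* suc d)       ∎)
  where open ≡-Reasoning

two-minus-square≢0 : (u : ℚ) → ℚ2 - u * u ≢ 0ℚ
two-minus-square≢0 u d≡0 = square≢prime prime[2] u (sym (x∙y⁻¹≈ε⇒x≈y ℚ2 (u * u) d≡0))

divide-by : ∀ x y c .{{_ : NonZero c}} → x * c ≡ y → x ≡ y * 1/ c
divide-by x y c xc≡y = begin
  x                ≡⟨ sym (*-identityʳ x) ⟩
  x * 1ℚ           ≡⟨ cong (x *_) (sym (*-inverseʳ c)) ⟩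
  x * (c * 1/ c)   ≡⟨ sym (*-assoc x c (1/ c)) ⟩
  x * c * 1/ c     ≡⟨ cong (_* 1/ c) xc≡y ⟩
  y * 1/ c         ∎
  where open ≡-Reasoning

fourth-power-difference : ∀ x y → (x + y) ⁴ ≡ (x - y) ⁴ + ℚ8 * (x * y * (x * x + y * y))
fourth-power-difference = solve 2 (λ x y →
    (x :+ y) :* (x :+ y) :* (x :+ y) :* (x :+ y)
  := (x :- y) :* (x :- y) :* (x :- y) :* (x :- y) :+ con ℚ8 :* (x :* y :* (x :* x :+ y :* y))) refl
  where open ℚ-Solver.+-*-Solver

biquadratic⇒quartic : ∀ p q r s a →
  p * q * (p * p + q * q) ≡ a * r * s * (r * r + s * s) →
  (p + q) ⁴ + a * (r - s) ⁴ ≡ (p - q) ⁴ + a * (r + s) ⁴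
biquadratic⇒quartic p q r s a biquadratic = begin
  (p + q) ⁴ + a * (r - s) ⁴
    ≡⟨ cong (_+ a * (r - s) ⁴) (fourth-power-difference p q) ⟩
  (p - q) ⁴ + ℚ8 * (p * q * (p * p + q * q)) + a * (r - s) ⁴
    ≡⟨ cong (λ z → (p - q) ⁴ + ℚ8 * z + a * (r - s) ⁴) biquadratic ⟩
  (p - q) ⁴ + ℚ8 * (a * r * s * (r * r + s * s)) + a * (r - s) ⁴
    ≡⟨ regroup ((p - q) ⁴) a ((r - s) ⁴) r s ⟩
  (p - q) ⁴ + a * ((r - s) ⁴ + ℚ8 * (r * s * (r * r + s * s)))
    ≡⟨ cong (λ z → (p - q) ⁴ + a * z) (sym (fourth-power-difference r s)) ⟩
  (p - q) ⁴ + a * (r + s) ⁴ ∎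
  where
  open ≡-Reasoning
  open ℚ-Solver.+-*-Solver
  regroup : ∀ c a b r s → c + ℚ8 * (a * r * s * (r * r + s * s)) + a * b
                        ≡ c + a * (b + ℚ8 * (r * s * (r * r + s * s)))
  regroup = solve 5 (λ c a b r s →
      c :+ con ℚ8 :* (a :* r :* s :* (r :* r :+ s :* s)) :+ a :* b
    := c :+ a :* (b :+ con ℚ8 :* (r :* s :* (r :* r :+ s :* s)))) refl

cleared-biquadratic : ∀ u → let open Param u in
  p * q * (p * p + q * q) * ℚ8 * (ℚ2 - u²) ≡ (ℚ4 * u² + 1ℚ) * (r * s * (r * r + s * s))
cleared-biquadratic = solve 1 (λ u →
  let u² = u :* u
      p = u :* (con ℚ4 :* u² :* u² :- con ℚ7 :* u² :+ con ℚ16)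
      q = con ℚ4 :* u² :* u² :- con ℚ19 :* u² :+ con ℚ4
      r = u :* (con ℚ4 :* u² :* u² :- con ℚ19 :* u² :+ con ℚ4)
      s = con ℚ8 :* (u² :+ con 1ℚ) :* (con ℚ2 :- u²)
  in p :* q :* (p :* p :+ q :* q) :* con ℚ8 :* (con ℚ2 :- u²)
     := (con ℚ4 :* u² :+ con 1ℚ) :* (r :* s :* (r :* r :+ s :* s))) refl
  where open ℚ-Solver.+-*-Solver

biquadratic : ∀ u (h : ℚ2 - u * u ≢ 0ℚ) → let open Param u in
  p * q * (p * p + q * q) ≡ a h * r * s * (r * r + s * s)
biquadratic u h = begin
  p * q * (p * p + q * q)               ≡⟨ divide-by _ _ ℚ8 (divide-by _ _ d (cleared-biquadratic u)) ⟩
  N * (r * s * (r * r + s * s)) * i * j ≡⟨ regroup N i j r s ⟩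
  N * j * i * r * s * (r * r + s * s)   ∎
  where
  open Param u
  open ≡-Reasoning
  open ℚ-Solver.+-*-Solver
  N d i j : ℚ
  N = ℚ4 * u² + 1ℚ
  d = ℚ2 - u²
  instance
    d≢0 : NonZero d
    d≢0 = ≢-nonZero h
  i = 1/ d
  j = 1/ ℚ8
  regroup : ∀ N i j r s → N * (r * s * (r * r + s * s)) * i * j ≡ N * j * i * r * s * (r * r + s * s)
  regroup = solve 5 (λ N i j r s →
    N :* (r :* s :* (r :* r :+ s :* s)) :* i :* j := N :* j :* i :* r :* s :* (r :* r :+ s :* s)) refl

mainTheorem11 : (u : ℚ) → let open Param u in
    Σ (ℚ2 - u² ≢ 0ℚ) λ h →
    (p * q * (p * p + q * q) ≡ a h * r * s * (r * r + s * s))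
    × (((p + q) ⁴ + a h * (r - s) ⁴) ≡ ((p - q) ⁴ + a h * (r + s) ⁴))
mainTheorem11 u = h , biquadratic u h , biquadratic⇒quartic p q r s (a h) (biquadratic u h)
  where
  open Param u
  h : ℚ2 - u² ≢ 0ℚ
  h = two-minus-square≢0 u
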